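{- Let $G$ be a connected graph without loops (multiple edges allowed) with vertex set $\{1,\dots,n\}$ and edges numbered $e_1,\dots,e_m$. Equip $G$ with the embedding of this numbering, and colour each face with a distinct colour. Follow the boundary of each face in the clockwise direction. Mark a vertex on this boundary with the colour of the face if either: - the edge preceding the vertex along the boundary has a larger number than the edge following it; or - the vertex has valency one. Let $\sigma=\tau_{e_m}\cdots\tau_{e_1}\in S_n$, where $\tau_{e}$ is the transposition exchanging the two endpoints of the edge $e$ and $\tau_{e_1}$ is applied first. Then the cycles of $\sigma$ (including cycles of length one) are in one-to-one correspondence with the faces of the embedding. The cycle corresponding to a face consists exactly of the vertices marked with the colour of that face.
   Context: An embedding of a graph is a choice of cyclic order of the half-edges at each vertex. It is regarded as the counterclockwise order of the half-edges around the vertex on an oriented surface in which the graph is cellularly embedded; the faces are the components of the complement. The embedding of an edge numbering is the embedding in which the cyclic order of the half-edges at each vertex is the increasing order of the numbers of the corresponding edges. -}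

module Defs where

open import Data.Nat using (ℕ)
open import Data.Fin using (Fin; _<_; _≤_; _≟_)
open import Data.Bool using (Bool; true; false; not; if_then_else_)
open import Data.Product using (Σ; _×_; _,_; proj₁)
open import Data.Sum using (_⊎_)
open import Data.List using (foldl; allFin)
open import Relation.Nullary using (¬_; does)
open import Relation.Binary.PropositionalEquality using (_≡_)
open import Relation.Binary.Construct.Closure.ReflexiveTransitive using (Star)

-- A graph on vertex set Fin n with m edges numbered 0 … m-1 (edge k is e_{k+1}).
-- Edge k has endpoints  end k false = src k  and  end k true = tgt k.
module _ {n m : ℕ} (src tgt : Fin m → Fin n) where

  Loopless : Set
  Loopless = ∀ k → ¬ (src k ≡ tgt k)

  data Reach : Fin n → Fin n → Set where
    here  : ∀ {x} → Reach x x
    fwd   : ∀ {y} k → Reach (tgt k) y → Reach (src k) y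
    bwd   : ∀ {y} k → Reach (src k) y → Reach (tgt k) y

  Connected : Set
  Connected = ∀ x y → Reach x y

  end : Fin m → Bool → Fin n
  end k false = src k
  end k true  = tgt k

  -- half-edges / darts: (edge, which end).  A dart starts at its tail.
  Dart : Set
  Dart = Fin m × Bool

  edge : Dart → Fin m
  edge = proj₁

  tail : Dart → Fin n
  tail (k , b) = end k b

  head : Dart → Fin n
  head (k , b) = end k (not b)

  rev : Dart → Dart
  rev (k , b) = (k , not b)

  -- Rotation of the embedding of the numbering: Rot d d' holds iff d' is the
  -- half-edge following d in the counterclockwise cyclic order at the vertex
  -- tail d, this order being the increasing order of edge numbers.
  Rot : Dart → Dart → Set
  Rot d d' =
    tail d' ≡ tail d ×
    ( ( edge d < edge d' ×
        (∀ e → tail e ≡ tail d → edge d < edge e → edge d' ≤ edge e) )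
    ⊎ ( (∀ e → tail e ≡ tail d → edge e ≤ edge d) ×
        (∀ e → tail e ≡ tail d → edge d' ≤ edge e) ) )

  -- Clockwise boundary walk of faces: after traversing dart d (arriving at
  -- head d), leave along the half-edge following rev d counterclockwise.
  FaceStep : Dart → Dart → Set
  FaceStep d d' = Rot (rev d) d'

  SameFace : Dart → Dart → Set
  SameFace = Star FaceStep

  ValencyOne : Fin n → Set
  ValencyOne x = Σ Dart λ d → tail d ≡ x × (∀ d' → tail d' ≡ x → d' ≡ d)

  -- vertex x is marked with the colour of the face whose boundary contains d:
  -- some corner of that face at x (preceding edge = edge d₁, following edge =
  -- edge d₂) has edge d₂ < edge d₁, or x has valency one.
  MarkedWith : Dart → Fin n → Set
  MarkedWith d x =
    Σ Dart λ d₁ → Σ Dart λ d₂ →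
      SameFace d d₁ × FaceStep d₁ d₂ × head d₁ ≡ x ×
      (edge d₂ < edge d₁ ⊎ ValencyOne x)

  τ : Fin m → Fin n → Fin n
  τ k x = if does (x ≟ src k) then tgt k
          else if does (x ≟ tgt k) then src k else x

  σ : Fin n → Fin n
  σ x = foldl (λ y k → τ k y) x (allFin m)

  SameCycle : Fin n → Fin n → Set
  SameCycle = Star (λ x y → σ x ≡ y)

module Submission where

-- Put a token on a vertex and apply τ_{e_1}, …, τ_{e_m} in turn: the token is carried across every
-- edge incident to its current position at the moment that edge's transposition is applied.  For a
-- dart d let dest d be the final position of a token that crosses d, i.e. that sits at the tail of d
-- just before τ_{edge d}.  Let d' follow d clockwise around a face.  If edge d < edge d', no edge
-- incident to head d has a number strictly between them, so the token crossing d next crosses d' and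
-- dest d = dest d'.  Otherwise d carries the last edge at head d and d' the first one, so the token
-- crossing d stays at head d for good while a token starting at head d first crosses d':
-- dest d = head d and dest d' = σ (head d).  Hence dest is constant between consecutive descent corners
-- of a face and advances by σ at each of them.  Every vertex x has exactly one descent corner, the one
-- entered along the last edge at x, and the descent corners are exactly the marked corners.

open import Data.Bool using (Bool; true; false; not)
open import Data.Bool.Properties using (not-involutive)
open import Data.Empty using (⊥; ⊥-elim)
open import Data.Fin using (Fin; zero; suc; toℕ; fromℕ<; _≟_; _≤_; _<_; _>_; _<?_)
open import Data.Fin.Induction using (>-wellFounded)
open import Data.Fin.Properties
  using (toℕ<n; fromℕ<-toℕ; toℕ-fromℕ<; pigeonhole; ≤-antisym; ≤-trans; <-irrefl; <-asym; 2↔Bool; *↔×)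
open import Data.List using (foldl; tabulate)
open import Data.Nat.Base as ℕ using (ℕ; zero; suc; _+_; z≤n; s≤s)
import Data.Nat.Properties as ℕ
open import Data.Nat.GeneralisedArithmetic using (iterate)
open import Data.Product using (Σ; _×_; _,_; proj₁; proj₂)
open import Data.Product.Function.NonDependent.Propositional using (_×-↔_)
open import Data.Sum using (_⊎_; inj₁; inj₂)
open import Function using (_∘_; id)
open import Function.Bundles using (_↣_; Injection; _⇔_; mk⇔)
open import Function.Definitions using (Injective)
open import Function.Properties.Inverse using (↔-refl; ↔-sym; ↔-trans; ↔⇒↣)
open import Induction.WellFounded using (Acc; acc)
open import Relation.Binary.Construct.Closure.ReflexiveTransitive using (Star; ε; _◅_; _◅◅_)
open import Relation.Binary.PropositionalEquality
  using (_≡_; _≢_; refl; sym; trans; cong; subst; module ≡-Reasoning)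
open import Relation.Nullary using (¬_; Dec; yes; no)
open import Relation.Nullary.Decidable using (_×-dec_)
import Defs
open Defs using (here; fwd; bwd)

least? : ∀ {m} (P : Fin m → Set) → (∀ k → Dec (P k)) →
         (∀ k → ¬ P k) ⊎ Σ (Fin m) λ k → P k × (∀ j → P j → k ≤ j)
least? {zero}  P P? = inj₁ λ ()
least? {suc m} P P? with P? zero
... | yes p₀ = inj₂ (zero , p₀ , λ _ _ → z≤n)
... | no ¬p₀ with least? (P ∘ suc) (P? ∘ suc)
...   | inj₁ none = inj₁ λ { zero → ¬p₀ ; (suc k) → none k }
...   | inj₂ (k , pk , least) =
  inj₂ (suc k , pk , λ { zero p₀ → ⊥-elim (¬p₀ p₀) ; (suc j) pj → s≤s (least j pj) })

greatest? : ∀ {m} (P : Fin m → Set) → (∀ k → Dec (P k)) →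
            (∀ k → ¬ P k) ⊎ Σ (Fin m) λ k → P k × (∀ j → P j → j ≤ k)
greatest? {zero}  P P? = inj₁ λ ()
greatest? {suc m} P P? with greatest? (P ∘ suc) (P? ∘ suc)
... | inj₂ (k , pk , greatest) =
  inj₂ (suc k , pk , λ { zero _ → z≤n ; (suc j) pj → s≤s (greatest j pj) })
... | inj₁ none with P? zero
...   | yes p₀ = inj₂ (zero , p₀ , λ { zero _ → z≤n ; (suc j) pj → ⊥-elim (none j pj) })
...   | no ¬p₀ = inj₁ λ { zero → ¬p₀ ; (suc k) → none k }

module Orbit {A : Set} {N : ℕ} (encode : A ↣ Fin N)
             {p : A → A} (p-injective : Injective _≡_ _≡_ p) where

  Step : A → A → Set
  Step a b = p a ≡ b

  iterate-+ : ∀ i j x → iterate p x (i + j) ≡ iterate p (iterate p x i) j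
  iterate-+ zero    j x = refl
  iterate-+ (suc i) j x = iterate-+ i j (p x)

  iterate-injective : ∀ i {x y} → iterate p x i ≡ iterate p y i → x ≡ y
  iterate-injective zero    eq = eq
  iterate-injective (suc i) eq = p-injective (iterate-injective i eq)

  star-iterate : ∀ k x → Star Step x (iterate p x k)
  star-iterate zero    x = ε
  star-iterate (suc k) x = refl ◅ star-iterate k (p x)

  -- Two of the first N + 1 iterates of x coincide, and injectivity cancels the common prefix.
  returns : ∀ x → Star Step (p x) x
  returns x with pigeonhole (ℕ.n<1+n N) (λ k → Injection.to encode (iterate p x (toℕ k)))
  ... | i , j , i<j , same with ℕ.m≤n⇒∃[o]m+o≡n i<j
  ...   | o , i+o≡j = subst (Star Step (p x)) (sym periodic) (star-iterate o (p x))
    where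
    open ≡-Reasoning
    periodic : x ≡ iterate p x (suc o)
    periodic = iterate-injective (toℕ i) (begin
      iterate p x (toℕ i)
        ≡⟨ Injection.injective encode same ⟩
      iterate p x (toℕ j)
        ≡⟨ cong (iterate p x) (trans (sym i+o≡j) (cong suc (ℕ.+-comm (toℕ i) o))) ⟩
      iterate p x (suc o + toℕ i)
        ≡⟨ iterate-+ (suc o) (toℕ i) x ⟩
      iterate p (iterate p x (suc o)) (toℕ i) ∎)

  orbit-sym : ∀ {x y} → Star Step x y → Star Step y x
  orbit-sym ε              = ε
  orbit-sym (refl ◅ steps) = orbit-sym steps ◅◅ returns _

module Run {X : Set} (g : ℕ → X → X) where

  run : ℕ → ℕ → X → X
  run i zero    x = x
  run i (suc t) x = run (suc i) t (g i x)

  run-+ : ∀ i s t x → run i (s + t) x ≡ run (i + s) t (run i s x)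
  run-+ i zero    t x = cong (λ k → run k t x) (sym (ℕ.+-identityʳ i))
  run-+ i (suc s) t x =
    trans (run-+ (suc i) s t (g i x))
          (cong (λ k → run k t (run (suc i) s (g i x))) (sym (ℕ.+-suc i s)))

  run-fix : ∀ i t x → (∀ j → i ℕ.≤ j → j ℕ.< i + t → g j x ≡ x) → run i t x ≡ x
  run-fix i zero    x fixed = refl
  run-fix i (suc t) x fixed =
    trans (cong (run (suc i) t) (fixed i ℕ.≤-refl (ℕ.m<m+n i ℕ.z<s)))
          (run-fix (suc i) t x λ j i<j j<i+t →
            fixed j (ℕ.<⇒≤ i<j) (subst (j ℕ.<_) (sym (ℕ.+-suc i t)) j<i+t))

  run-pad : ∀ i t s x → (∀ j → i + t ℕ.≤ j → g j (run i t x) ≡ run i t x) →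
            run i (t + s) x ≡ run i t x
  run-pad i t s x fixed = trans (run-+ i t s x) (run-fix (i + t) s _ λ j le _ → fixed j le)

  foldl-tabulate : ∀ {A : Set} (f : A → X → X) i {k} (h : Fin k → A) →
                   (∀ j y → f (h j) y ≡ g (i + toℕ j) y) →
                   ∀ x → foldl (λ y a → f a y) x (tabulate h) ≡ run i k x
  foldl-tabulate f i {zero}  h agree x = refl
  foldl-tabulate f i {suc k} h agree x =
    trans (foldl-tabulate f (suc i) (h ∘ suc)
             (λ j y → trans (agree (suc j) y) (cong (λ l → g l y) (ℕ.+-suc i (toℕ j)))) _)
          (cong (run (suc i) k) (trans (agree zero x) (cong (λ l → g l x) (ℕ.+-identityʳ i))))

module Graph {n m : ℕ} (src tgt : Fin m → Fin n) where

  Dart : Set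
  Dart = Defs.Dart src tgt

  edge : Dart → Fin m
  edge = Defs.edge src tgt

  index : Dart → ℕ
  index d = toℕ (edge d)

  tail head : Dart → Fin n
  tail = Defs.tail src tgt
  head = Defs.head src tgt

  rev : Dart → Dart
  rev = Defs.rev src tgt

  τ : Fin m → Fin n → Fin n
  τ = Defs.τ src tgt

  σ : Fin n → Fin n
  σ = Defs.σ src tgt

  Rot FaceStep SameFace : Dart → Dart → Set
  Rot      = Defs.Rot src tgt
  FaceStep = Defs.FaceStep src tgt
  SameFace = Defs.SameFace src tgt

  SameCycle : Fin n → Fin n → Set
  SameCycle = Defs.SameCycle src tgt

  ValencyOne : Fin n → Set
  ValencyOne = Defs.ValencyOne src tgt

  MarkedWith : Dart → Fin n → Set
  MarkedWith = Defs.MarkedWith src tgt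

  connected⇒incident : Defs.Connected src tgt → 1 ℕ.≤ m →
                       ∀ x → Σ Dart λ d → tail d ≡ x
  connected⇒incident connected 1≤m x = first-edge (connected x (src k₀)) refl
    where
    k₀ : Fin m
    k₀ = fromℕ< 1≤m
    first-edge : ∀ {y} → Defs.Reach src tgt x y → y ≡ src k₀ → Σ Dart λ d → tail d ≡ x
    first-edge here      x≡src = (k₀ , false) , sym x≡src
    first-edge (fwd k _) _     = (k , false) , refl
    first-edge (bwd k _) _     = (k , true) , refl

module Faces {n m : ℕ} (src tgt : Fin m → Fin n) (loopless : Defs.Loopless src tgt) where

  open Graph src tgt
  open ≡-Reasoning

  rev-injective : ∀ {a b} → rev a ≡ rev b → a ≡ b
  rev-injective {k , false} {.k , false} refl = refl
  rev-injective {k , true}  {.k , true}  refl = refl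

  dart-unique : ∀ {d d'} → tail d ≡ tail d' → edge d ≡ edge d' → d ≡ d'
  dart-unique {k , false} {.k , false} _ refl = refl
  dart-unique {k , true}  {.k , true}  _ refl = refl
  dart-unique {k , false} {.k , true}  t refl = ⊥-elim (loopless k t)
  dart-unique {k , true}  {.k , false} t refl = ⊥-elim (loopless k (sym t))

  τ-tail : ∀ d → τ (edge d) (tail d) ≡ head d
  τ-tail (k , false) with src k ≟ src k
  ... | yes _   = refl
  ... | no s≢s  = ⊥-elim (s≢s refl)
  τ-tail (k , true) with tgt k ≟ src k
  ... | yes t≡s = ⊥-elim (loopless k (sym t≡s))
  ... | no _ with tgt k ≟ tgt k
  ...   | yes _  = refl
  ...   | no t≢t = ⊥-elim (t≢t refl)

  τ-fix : ∀ k x → x ≢ src k → x ≢ tgt k → τ k x ≡ x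
  τ-fix k x x≢s x≢t with x ≟ src k
  ... | yes x≡s = ⊥-elim (x≢s x≡s)
  ... | no _ with x ≟ tgt k
  ...   | yes x≡t = ⊥-elim (x≢t x≡t)
  ...   | no _    = refl

  τℕ : ℕ → Fin n → Fin n
  τℕ j x with j ℕ.<? m
  ... | yes j<m = τ (fromℕ< j<m) x
  ... | no _    = x

  τℕ-toℕ : ∀ k x → τℕ (toℕ k) x ≡ τ k x
  τℕ-toℕ k x with toℕ k ℕ.<? m
  ... | yes k<m = cong (λ k′ → τ k′ x) (fromℕ<-toℕ k k<m)
  ... | no k≮m  = ⊥-elim (k≮m (toℕ<n k))

  τℕ-fix : ∀ j x → (∀ d → tail d ≡ x → index d ≢ j) → τℕ j x ≡ x
  τℕ-fix j x unused with j ℕ.<? m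
  ... | no _    = refl
  ... | yes j<m = τ-fix (fromℕ< j<m) x
    (λ x≡s → unused (fromℕ< j<m , false) (sym x≡s) (toℕ-fromℕ< j<m))
    (λ x≡t → unused (fromℕ< j<m , true) (sym x≡t) (toℕ-fromℕ< j<m))

  τℕ-beyond : ∀ {j} x → m ℕ.≤ j → τℕ j x ≡ x
  τℕ-beyond x m≤j = τℕ-fix _ x λ d _ d≡j →
    ℕ.≤⇒≯ m≤j (subst (ℕ._< m) d≡j (toℕ<n (edge d)))

  open Run τℕ

  -- Since τℕ is the identity beyond m, running m steps from i applies exactly τ_i, …, τ_{m-1}.
  after : ℕ → Fin n → Fin n
  after i = run i m

  after-pad : ∀ i s x → run i (m + s) x ≡ after i x
  after-pad i s x = run-pad i m s x λ j i+m≤j →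
    τℕ-beyond _ (ℕ.≤-trans (ℕ.m≤n+m m i) i+m≤j)

  NoEdgeIn : Fin n → ℕ → ℕ → Set
  NoEdgeIn x i k = ∀ d → tail d ≡ x → i ℕ.≤ index d → index d ℕ.< k → ⊥

  after-step : ∀ i x → after i x ≡ after (suc i) (τℕ i x)
  after-step i x = begin
    run i m x        ≡⟨ after-pad i 1 x ⟨
    run i (m + 1) x  ≡⟨ cong (λ t → run i t x) (ℕ.+-comm m 1) ⟩
    run i (suc m) x  ∎

  after-skip : ∀ {i k x} → i ℕ.≤ k → NoEdgeIn x i k → after i x ≡ after k x
  after-skip {i} {k} {x} i≤k none with ℕ.m≤n⇒∃[o]m+o≡n i≤k
  ... | l , refl = begin
    run i m x                  ≡⟨ after-pad i l x ⟨
    run i (m + l) x            ≡⟨ cong (λ t → run i t x) (ℕ.+-comm m l) ⟩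
    run i (l + m) x            ≡⟨ run-+ i l m x ⟩
    run (i + l) m (run i l x)  ≡⟨ cong (run (i + l) m) (run-fix i l x untouched) ⟩
    run (i + l) m x            ∎
    where
    untouched : ∀ j → i ℕ.≤ j → j ℕ.< i + l → τℕ j x ≡ x
    untouched j i≤j j<k = τℕ-fix j x λ d td d≡j →
      none d td (subst (i ℕ.≤_) (sym d≡j) i≤j) (subst (ℕ._< i + l) (sym d≡j) j<k)

  after-fix : ∀ {i x} → (∀ d → tail d ≡ x → index d ℕ.< i) → after i x ≡ x
  after-fix {i} {x} below = run-fix i m x λ j i≤j _ →
    τℕ-fix j x λ d td d≡j → ℕ.≤⇒≯ i≤j (subst (ℕ._< i) d≡j (below d td))

  σ-after : ∀ x → σ x ≡ after 0 x
  σ-after = foldl-tabulate τ 0 id (λ j y → sym (τℕ-toℕ j y))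

  dest : Dart → Fin n
  dest d = after (index d) (tail d)

  dest-head : ∀ d → dest d ≡ after (suc (index d)) (head d)
  dest-head d = begin
    after (index d) (tail d)                       ≡⟨ after-step (index d) (tail d) ⟩
    after (suc (index d)) (τℕ (index d) (tail d))  ≡⟨ cong (after (suc (index d))) crosses ⟩
    after (suc (index d)) (head d)                 ∎
    where
    crosses : τℕ (index d) (tail d) ≡ head d
    crosses = trans (τℕ-toℕ (edge d) (tail d)) (τ-tail d)

  Incident : Fin n → Fin m → Set
  Incident x k = Σ Bool λ b → tail (k , b) ≡ x

  incident? : ∀ x k → Dec (Incident x k)
  incident? x k with src k ≟ x | tgt k ≟ x
  ... | yes s≡x | _       = yes (false , s≡x)
  ... | no _    | yes t≡x = yes (true , t≡x)
  ... | no s≢x  | no t≢x  = no λ where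
    (false , s≡x) → s≢x s≡x
    (true  , t≡x) → t≢x t≡x

  rot-exists : ∀ a → Σ Dart (Rot a)
  rot-exists a with least? (λ k → Incident (tail a) k × edge a < k)
                           (λ k → incident? (tail a) k ×-dec edge a <? k)
  ... | inj₂ (k , ((b , at) , above) , least) =
    (k , b) , at , inj₁ (above , λ e te a<e → least (edge e) ((proj₂ e , te) , a<e))
  ... | inj₁ none-above with least? (Incident (tail a)) (incident? (tail a))
  ...   | inj₁ none = ⊥-elim (none (edge a) (proj₂ a , refl))
  ...   | inj₂ (k , (b , at) , least) =
    (k , b) , at , inj₂ (greatest , λ e te → least (edge e) (proj₂ e , te))
    where
    greatest : ∀ e → tail e ≡ tail a → edge e ≤ edge a
    greatest e te = ℕ.≮⇒≥ λ a<e → none-above (edge e) ((proj₂ e , te) , a<e)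

  rot-functional : ∀ {a d₁ d₂} → Rot a d₁ → Rot a d₂ → d₁ ≡ d₂
  rot-functional {d₁ = d₁} {d₂} (t₁ , inj₁ (a<d₁ , least₁)) (t₂ , inj₁ (a<d₂ , least₂)) =
    dart-unique (trans t₁ (sym t₂)) (≤-antisym (least₁ d₂ t₂ a<d₂) (least₂ d₁ t₁ a<d₁))
  rot-functional {d₁ = d₁} (t₁ , inj₁ (a<d₁ , _)) (_ , inj₂ (top , _)) =
    ⊥-elim (ℕ.≤⇒≯ (top d₁ t₁) a<d₁)
  rot-functional {d₂ = d₂} (_ , inj₂ (top , _)) (t₂ , inj₁ (a<d₂ , _)) =
    ⊥-elim (ℕ.≤⇒≯ (top d₂ t₂) a<d₂)
  rot-functional {d₁ = d₁} {d₂} (t₁ , inj₂ (_ , least₁)) (t₂ , inj₂ (_ , least₂)) =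
    dart-unique (trans t₁ (sym t₂)) (≤-antisym (least₁ d₂ t₂) (least₂ d₁ t₁))

  rot-injective : ∀ {a b d} → Rot a d → Rot b d → a ≡ b
  rot-injective {a} {b} (t₁ , inj₁ (a<d , least₁)) (t₂ , inj₁ (b<d , least₂)) =
    dart-unique ta≡tb (≤-antisym
      (ℕ.≮⇒≥ λ b<a → ℕ.≤⇒≯ (least₂ a ta≡tb b<a) a<d)
      (ℕ.≮⇒≥ λ a<b → ℕ.≤⇒≯ (least₁ b (sym ta≡tb) a<b) b<d))
    where
    ta≡tb : tail a ≡ tail b
    ta≡tb = trans (sym t₁) t₂
  rot-injective {a} (t₁ , inj₁ (a<d , _)) (t₂ , inj₂ (_ , least)) =
    ⊥-elim (ℕ.≤⇒≯ (least a (trans (sym t₁) t₂)) a<d)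
  rot-injective {b = b} (t₁ , inj₂ (_ , least)) (t₂ , inj₁ (b<d , _)) =
    ⊥-elim (ℕ.≤⇒≯ (least b (trans (sym t₂) t₁)) b<d)
  rot-injective {a} {b} (t₁ , inj₂ (top₁ , _)) (t₂ , inj₂ (top₂ , _)) =
    dart-unique ta≡tb (≤-antisym (top₂ a ta≡tb) (top₁ b (sym ta≡tb)))
    where
    ta≡tb : tail a ≡ tail b
    ta≡tb = trans (sym t₁) t₂

  next : Dart → Dart
  next d = proj₁ (rot-exists (rev d))

  next-step : ∀ d → FaceStep d (next d)
  next-step d = proj₂ (rot-exists (rev d))

  next-injective : Injective _≡_ _≡_ next
  next-injective {a} {b} eq =
    rev-injective (rot-injective {rev a} {rev b} {next a} (next-step a)
                                 (subst (FaceStep b) (sym eq) (next-step b)))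

  dart↣Fin : Dart ↣ Fin (m ℕ.* 2)
  dart↣Fin = ↔⇒↣ (↔-trans (↔-refl ×-↔ ↔-sym 2↔Bool) (↔-sym *↔×))

  open Orbit dart↣Fin next-injective using (Step; orbit-sym)

  sameFace⇒orbit : ∀ {d d'} → SameFace d d' → Star Step d d'
  sameFace⇒orbit ε = ε
  sameFace⇒orbit {d} (step ◅ steps) =
    rot-functional {rev d} (next-step d) step ◅ sameFace⇒orbit steps

  orbit⇒sameFace : ∀ {d d'} → Star Step d d' → SameFace d d'
  orbit⇒sameFace ε = ε
  orbit⇒sameFace {d} (refl ◅ steps) = next-step d ◅ orbit⇒sameFace steps

  sameFace-sym : ∀ {d d'} → SameFace d d' → SameFace d' d
  sameFace-sym = orbit⇒sameFace ∘ orbit-sym ∘ sameFace⇒orbit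

  record LastInto (y : Fin n) (w : Dart) : Set where
    constructor lastInto
    field
      enters  : head w ≡ y
      maximal : ∀ d → tail d ≡ y → edge d ≤ edge w

  record FirstOutOf (y : Fin n) (w : Dart) : Set where
    constructor firstOutOf
    field
      leaves  : tail w ≡ y
      minimal : ∀ d → tail d ≡ y → edge w ≤ edge d

  data Corner (d d' : Dart) : Set where
    ascent  : edge d < edge d' → dest d ≡ dest d' → Corner d d'
    descent : LastInto (head d) d → FirstOutOf (head d) d' → Corner d d'

  corner : ∀ d d' → FaceStep d d' → Corner d d'
  corner d d' (t , inj₁ (d<d' , least)) = ascent d<d' (begin
    dest d                          ≡⟨ dest-head d ⟩
    after (suc (index d)) (head d)  ≡⟨ after-skip d<d' between ⟩
    after (index d') (head d)       ≡⟨ cong (after (index d')) t ⟨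
    dest d'                         ∎)
    where
    between : NoEdgeIn (head d) (suc (index d)) (index d')
    between e te d<e e<d' = ℕ.≤⇒≯ (least e te d<e) e<d'
  corner d d' (t , inj₂ (last , first)) = descent (lastInto refl last) (firstOutOf t first)

  dest-last : ∀ {y w} → LastInto y w → dest w ≡ y
  dest-last {w = w} (lastInto refl last) = trans (dest-head w) (after-fix λ d td → s≤s (last d td))

  dest-first : ∀ {y d} → FirstOutOf y d → σ y ≡ dest d
  dest-first {d = d} (firstOutOf refl first) =
    trans (σ-after (tail d)) (after-skip z≤n λ e te _ e<d → ℕ.≤⇒≯ (first e te) e<d)

  last-unique : ∀ {y w w'} → LastInto y w → LastInto y w' → w ≡ w'
  last-unique {w = w} {w'} (lastInto h last) (lastInto h' last') =
    rev-injective (dart-unique (trans h (sym h')) (≤-antisym (last' (rev w) h) (last (rev w') h')))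

  next-of-last : ∀ {y w} → LastInto y w → FirstOutOf y (next w)
  next-of-last {w = w} (lastInto refl last) with next-step w
  ... | t , inj₁ (w<next , _) = ⊥-elim (ℕ.≤⇒≯ (last (next w) t) w<next)
  ... | t , inj₂ (_ , first)  = firstOutOf t first

  reach-last : ∀ d → Σ Dart λ w → SameFace d w × LastInto (dest d) w
  reach-last d = go d (>-wellFounded (edge d))
    where
    go : ∀ d → Acc _>_ (edge d) → Σ Dart λ w → SameFace d w × LastInto (dest d) w
    go d (acc further) with corner d (next d) (next-step d)
    ... | descent last _ = d , ε , subst (λ y → LastInto y d) (sym (dest-last last)) last
    ... | ascent d<next same with go (next d) (further d<next)
    ...   | w , face , last = w , next-step d ◅ face , subst (λ y → LastInto y w) (sym same) last

  sameFace⇒sameCycle : ∀ {d d'} → SameFace d d' → SameCycle (dest d) (dest d')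
  sameFace⇒sameCycle ε = ε
  sameFace⇒sameCycle {d} {d'} (_◅_ {j = d₁} step steps) with corner d d₁ step
  ... | ascent _ same =
    subst (λ y → SameCycle y (dest d')) (sym same) (sameFace⇒sameCycle steps)
  ... | descent last first =
    trans (cong σ (dest-last last)) (dest-first first) ◅ sameFace⇒sameCycle steps

  sameCycle⇒sameFace-last : ∀ {y z w w'} → SameCycle y z →
                            LastInto y w → LastInto z w' → SameFace w w'
  sameCycle⇒sameFace-last ε last last' = subst (SameFace _) (last-unique last last') ε
  sameCycle⇒sameFace-last {w = w} (refl ◅ steps) last last' with reach-last (next w)
  ... | w″ , face , last″ =
    next-step w ◅ face ◅◅ sameCycle⇒sameFace-last steps last-σ last'
    where
    last-σ : LastInto _ w″
    last-σ = subst (λ y → LastInto y w″) (sym (dest-first (next-of-last last))) last″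

  sameCycle⇒sameFace : ∀ {d d'} → SameCycle (dest d) (dest d') → SameFace d d'
  sameCycle⇒sameFace {d} {d'} cycle with reach-last d | reach-last d'
  ... | w , face , last | w' , face' , last' =
    face ◅◅ sameCycle⇒sameFace-last cycle last last' ◅◅ sameFace-sym face'

  last-exists : ∀ {y} → Σ Dart (λ d → tail d ≡ y) → Σ Dart (LastInto y)
  last-exists {y} (d , td) with greatest? (Incident y) (incident? y)
  ... | inj₁ none = ⊥-elim (none (edge d) (proj₂ d , td))
  ... | inj₂ (k , (b , at) , greatest) =
    rev (k , b) , lastInto (subst (λ b′ → tail (k , b′) ≡ y) (sym (not-involutive b)) at)
                           (λ e te → greatest (edge e) (proj₂ e , te))

  valency-one : ∀ {x w d} → LastInto x w → FirstOutOf x d → edge w ≤ edge d → ValencyOne x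
  valency-one {d = d} (lastInto _ last) (firstOutOf t first) w≤d =
    d , t , λ d' t' →
      dart-unique (trans t' (sym t)) (≤-antisym (≤-trans (last d' t') w≤d) (first d' t'))

  last-corner-marked : ∀ {x w} → LastInto x w → edge (next w) < edge w ⊎ ValencyOne x
  last-corner-marked {w = w} last with edge (next w) <? edge w
  ... | yes descends = inj₁ descends
  ... | no ¬descends = inj₂ (valency-one last (next-of-last last) (ℕ.≮⇒≥ ¬descends))

  ascent-unmarked : ∀ d d' → FaceStep d d' → edge d < edge d' →
                    ¬ (edge d' < edge d ⊎ ValencyOne (head d))
  ascent-unmarked d d' _ d<d' (inj₁ d'<d) = <-asym d<d' d'<d
  ascent-unmarked d d' (t , _) d<d' (inj₂ (_ , _ , unique)) =
    <-irrefl (cong edge (trans (unique (rev d) refl) (sym (unique d' t)))) d<d'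

  sameCycle⇒marked : ∀ {d x} → Σ Dart (λ c → tail c ≡ x) →
                     SameCycle (dest d) x → MarkedWith d x
  sameCycle⇒marked {d} incident cycle with reach-last d | last-exists incident
  ... | w , face , last | wₓ , lastₓ =
    wₓ , next wₓ , face ◅◅ sameCycle⇒sameFace-last cycle last lastₓ , next-step wₓ ,
    LastInto.enters lastₓ , last-corner-marked lastₓ

  marked⇒sameCycle : ∀ {d x} → MarkedWith d x → SameCycle (dest d) x
  marked⇒sameCycle (d₁ , d₂ , face , step , refl , mark) with corner d₁ d₂ step
  ... | ascent d₁<d₂ _ = ⊥-elim (ascent-unmarked d₁ d₂ step d₁<d₂ mark)
  ... | descent last _ = subst (SameCycle _) (dest-last last) (sameFace⇒sameCycle face)

open Defs using (Loopless; Connected; Dart; SameFace; SameCycle; MarkedWith)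

proposition6 : (n m : ℕ) (src tgt : Fin m → Fin n) →
    Loopless src tgt → Connected src tgt → 1 ℕ.≤ m →
    Σ (Dart src tgt → Fin n) λ f →
      ((d d' : Dart src tgt) → SameFace src tgt d d' → SameCycle src tgt (f d) (f d')) ×
      ((d d' : Dart src tgt) → SameCycle src tgt (f d) (f d') → SameFace src tgt d d') ×
      ((x : Fin n) → Σ (Dart src tgt) λ d → SameCycle src tgt (f d) x) ×
      ((d : Dart src tgt) (x : Fin n) → SameCycle src tgt (f d) x ⇔ MarkedWith src tgt d x)
proposition6 n m src tgt loopless connected 1≤m =
    dest
  , (λ _ _ → sameFace⇒sameCycle)
  , (λ _ _ → sameCycle⇒sameFace)
  , (λ x → let w , last = last-exists (incident x) in
             w , subst (SameCycle src tgt (dest w)) (dest-last last) ε)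
  , (λ _ x → mk⇔ (sameCycle⇒marked (incident x)) marked⇒sameCycle)
  where
  open Faces src tgt loopless
  incident : ∀ x → Σ (Dart src tgt) λ d → Defs.tail src tgt d ≡ x
  incident = Graph.connected⇒incident src tgt connected 1≤m
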